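{- Let $\mathfrak{M},\mathfrak{N}$ be $\Delta$-models and let $B=(B_\ell)_{\ell\in\omega}$ be an $\omega$-bisimulation from $\mathfrak{M}$ to $\mathfrak{N}$ with $\mu\mathrel{B_0}\nu$, and suppose $(\mu,\mu')\mathrel{B_1}(\nu,\nu')$ for some $\mu,\mu'\in|\mathfrak{M}|$, $\nu,\nu'\in|\mathfrak{N}|$. Let $x$ be a fresh variable and define $B^x=(B^x_\ell)_{\ell\in\omega}$ by $(\overline{w},w)\mathrel{B^x_\ell}(\overline{v},v)$ iff $(\mu\,\overline{w},w)\mathrel{B_{\ell+1}}(\nu\,\overline{v},v)$, for all $\ell\in\omega$, $(\overline{w},w)\in|\mathfrak{M}|^\ell\times|\mathfrak{M}|$, $(\overline{v},v)\in|\mathfrak{N}|^\ell\times|\mathfrak{N}|$ (juxtaposition denotes concatenation of sequences). Then $B^x$ is an $\omega$-bisimulation (over the signature $\Delta[x]$) from $\mathfrak{M}[x\leftarrow\mu]$ to $\mathfrak{N}[x\leftarrow\nu]$ with $\mu'\mathrel{B^x_0}\nu'$, i.e. between the pointed models $(\mathfrak{M}[x\leftarrow\mu],\mu')$ and $(\mathfrak{N}[x\leftarrow\nu],\nu')$.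
   Context: Hybrid-dynamic propositional logic (HDPL). A signature is $\Delta=((F,P),\mathtt{Prop})$ with $F$ nominals, $P$ binary relation symbols, $\mathtt{Prop}$ propositional symbols; $\Delta[x]$ adds a fresh nominal $x$. A $\Delta$-model $\mathfrak{M}$: a nonempty set $|\mathfrak{M}|$ of states, states $k^{\mathfrak{M}}$ ($k\in F$), relations $\lambda^{\mathfrak{M}}\subseteq|\mathfrak{M}|^2$ ($\lambda\in P$), and $M(w)\subseteq\mathtt{Prop}$ for each state $w$; $\mathfrak{M}[x\leftarrow w]$ is the $\Delta[x]$-expansion with $x^{\mathfrak{M}[x\leftarrow w]}=w$. Actions: $\mathfrak{a}::=\lambda\mid\mathfrak{a}\cup\mathfrak{a}\mid\mathfrak{a};\mathfrak{a}\mid\mathfrak{a}^*$, interpreted as union, composition, reflexive-transitive closure; $\mathfrak{a}^{\mathfrak{M}}(w)=\{w'\mid (w,w')\in\mathfrak{a}^{\mathfrak{M}}\}$. $\mathcal{L}$ is a fixed fragment of HDPL obtained by discarding some action constructors and/or some of the sentence constructors $\Diamond$ (possibility $\langle\mathfrak{a}\rangle$), $@$ (retrieve), $\downarrow$ (store), $\exists$; $\mathcal{O}\subseteq\{\Diamond,@,\downarrow,\exists\}$ is the set of retained constructors and $\mathcal{A}(\Delta)$ the set of $\mathcal{L}$-actions over $\Delta$. $\omega$-bisimulation: for $\ell\in\omega$, a relation $B_\ell\subseteq(|\mathfrak{M}|^\ell\times|\mathfrak{M}|)\times(|\mathfrak{N}|^\ell\times|\mathfrak{N}|)$ is an $\ell$-bisimulation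 if for all $(\overline{w},w)\mathrel{B_\ell}(\overline{v},v)$: (prop) $p\in M(w)$ iff $p\in N(v)$ for all $p\in\mathtt{Prop}$; (nom) $w=k^{\mathfrak{M}}$ iff $v=k^{\mathfrak{N}}$ for all $k\in F$; (wvar) $\overline{w}(j)=w$ iff $\overline{v}(j)=v$ for $1\le j\le\ell$; (forth) if $\Diamond\in\mathcal{O}$, for all $\mathfrak{a}\in\mathcal{A}(\Delta)$ and $w'\in\mathfrak{a}^{\mathfrak{M}}(w)$ there is $v'\in\mathfrak{a}^{\mathfrak{N}}(v)$ with $(\overline{w},w')\mathrel{B_\ell}(\overline{v},v')$; (back) symmetric; (atv) if $@\in\mathcal{O}$, $(\overline{w},\overline{w}(j))\mathrel{B_\ell}(\overline{v},\overline{v}(j))$ for $1\le j\le\ell$; (atn) if $@\in\mathcal{O}$, $(\overline{w},k^{\mathfrak{M}})\mathrel{B_\ell}(\overline{v},k^{\mathfrak{N}})$ for all $k\in F$. An $\omega$-bisimulation from $\mathfrak{M}$ to $\mathfrak{N}$ is a family $(B_\ell)_{\ell\in\omega}$ of $\ell$-bisimulations such that whenever $(\overline{w},w)\mathrel{B_\ell}(\overline{v},v)$: (st) if $\downarrow\in\mathcal{O}$ then $(\overline{w}\,w,w)\mathrel{B_{\ell+1}}(\overline{v}\,v,v)$; (ex) if $\exists\in\mathcal{O}$ then for all $w'\in|\mathfrak{M}|$ there is $v'\in|\mathfrak{N}|$ with $(\overline{w}\,w',w)\mathrel{B_{\ell+1}}(\overline{v}\,v',v)$, and for all $v'\in|\mathfrak{N}|$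 there is $w'\in|\mathfrak{M}|$ with the same. An $\omega$-bisimulation between pointed models $(\mathfrak{M},w)$ and $(\mathfrak{N},v)$ is one with $w\mathrel{B_0}v$. -}

module Defs where

open import Data.Bool using (Bool; T)
open import Data.Maybe using (Maybe; just; nothing)
open import Data.Nat using (ℕ; suc)
open import Data.Fin using (Fin)
open import Data.Vec using (Vec; []; _∷_; _∷ʳ_; lookup)
open import Data.Product using (Σ; ∃; _×_; _,_)
open import Data.Sum using (_⊎_)
open import Function.Bundles using (_⇔_)
open import Relation.Binary.PropositionalEquality using (_≡_)
open import Relation.Binary.Construct.Closure.ReflexiveTransitive using (Star)

-- Signatures Δ = ((F , P) , Prop)
record Sig : Set₁ where
  field
    Nom  : Set
    Rel  : Set
    Prp  : Set
open Sig public

-- Δ[x]: add one fresh nominal x (represented by `nothing`)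
_[x] : Sig → Sig
Δ [x] = record { Nom = Maybe (Nom Δ) ; Rel = Rel Δ ; Prp = Prp Δ }

record Model (Δ : Sig) : Set₁ where
  field
    St       : Set
    inhabited : St
    nom      : Nom Δ → St
    rel      : Rel Δ → St → St → Set
    val      : St → Prp Δ → Set
open Model public

_[x←_] : {Δ : Sig} → (M : Model Δ) → St M → Model (Δ [x])
M [x← w ] = record
  { St = St M
  ; inhabited = inhabited M
  ; nom = λ { nothing → w ; (just k) → nom M k }
  ; rel = rel M
  ; val = val M
  }

-- The fragment ℒ: which action constructors and sentence constructors are kept
record Fragment : Set where
  field
    hasUnion : Bool
    hasComp  : Bool
    hasStar  : Bool
    hasDia   : Bool
    hasAt    : Bool
    hasStore : Bool
    hasEx    : Bool
open Fragment public

data Act (R : Set) : Set where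
  atom  : R → Act R
  _∪ₐ_  : Act R → Act R → Act R
  _⨾_   : Act R → Act R → Act R
  _⋆    : Act R → Act R

data IsLAct (L : Fragment) {R : Set} : Act R → Set where
  atom  : (r : R) → IsLAct L (atom r)
  union : {a b : Act R} → T (hasUnion L) → IsLAct L a → IsLAct L b → IsLAct L (a ∪ₐ b)
  comp  : {a b : Act R} → T (hasComp L) → IsLAct L a → IsLAct L b → IsLAct L (a ⨾ b)
  star  : {a : Act R} → T (hasStar L) → IsLAct L a → IsLAct L (a ⋆)

⟦_⟧ : {Δ : Sig} → Act (Rel Δ) → (M : Model Δ) → St M → St M → Set
⟦ atom r ⟧ M = rel M r
⟦ a ∪ₐ b ⟧ M w w′ = ⟦ a ⟧ M w w′ ⊎ ⟦ b ⟧ M w w′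
⟦ a ⨾ b ⟧ M w w′ = Σ (St M) λ u → ⟦ a ⟧ M w u × ⟦ b ⟧ M u w′
⟦ a ⋆ ⟧ M = Star (⟦ a ⟧ M)

BRel : {Δ : Sig} → Model Δ → Model Δ → ℕ → Set₁
BRel M N ℓ = Vec (St M) ℓ → St M → Vec (St N) ℓ → St N → Set

-- ℓ-bisimulation (indices j : Fin ℓ correspond to 1 ≤ j ≤ ℓ)
record IsLBisim (L : Fragment) {Δ : Sig} (M N : Model Δ) (ℓ : ℕ)
                (B : BRel M N ℓ) : Set₁ where
  field
    prop : ∀ {ws w vs v} → B ws w vs v → (p : Prp Δ) → val M w p ⇔ val N v p
    nomc : ∀ {ws w vs v} → B ws w vs v → (k : Nom Δ) → (w ≡ nom M k) ⇔ (v ≡ nom N k)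
    wvar : ∀ {ws w vs v} → B ws w vs v → (j : Fin ℓ) → (lookup ws j ≡ w) ⇔ (lookup vs j ≡ v)
    forth : T (hasDia L) → ∀ {ws w vs v} → B ws w vs v →
            (a : Act (Rel Δ)) → IsLAct L a → (w′ : St M) → ⟦ a ⟧ M w w′ →
            Σ (St N) λ v′ → ⟦ a ⟧ N v v′ × B ws w′ vs v′
    back  : T (hasDia L) → ∀ {ws w vs v} → B ws w vs v →
            (a : Act (Rel Δ)) → IsLAct L a → (v′ : St N) → ⟦ a ⟧ N v v′ →
            Σ (St M) λ w′ → ⟦ a ⟧ M w w′ × B ws w′ vs v′
    atv  : T (hasAt L) → ∀ {ws w vs v} → B ws w vs v → (j : Fin ℓ) →
           B ws (lookup ws j) vs (lookup vs j)
    atn  : T (hasAt L) → ∀ {ws w vs v} → B ws w vs v → (k : Nom Δ) →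
           B ws (nom M k) vs (nom N k)

record IsωBisim (L : Fragment) {Δ : Sig} (M N : Model Δ)
                (B : (ℓ : ℕ) → BRel M N ℓ) : Set₁ where
  field
    level : (ℓ : ℕ) → IsLBisim L M N ℓ (B ℓ)
    st : T (hasStore L) → ∀ {ℓ ws w vs v} → B ℓ ws w vs v →
         B (suc ℓ) (ws ∷ʳ w) w (vs ∷ʳ v) v
    ex : T (hasEx L) → ∀ {ℓ ws w vs v} → B ℓ ws w vs v →
         ((w′ : St M) → Σ (St N) λ v′ → B (suc ℓ) (ws ∷ʳ w′) w (vs ∷ʳ v′) v)
         × ((v′ : St N) → Σ (St M) λ w′ → B (suc ℓ) (ws ∷ʳ w′) w (vs ∷ʳ v′) v)

IsPointedωBisim : (L : Fragment) {Δ : Sig} (M N : Model Δ)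
                  (B : (ℓ : ℕ) → BRel M N ℓ) → St M → St N → Set₁
IsPointedωBisim L M N B w v = IsωBisim L M N B × B 0 [] w [] v

shiftB : {Δ : Sig} {M N : Model Δ} → (B : (ℓ : ℕ) → BRel M N ℓ) →
         (μ : St M) (ν : St N) → (ℓ : ℕ) → BRel (M [x← μ ]) (N [x← ν ]) ℓ
shiftB B μ ν ℓ ws w vs v = B (suc ℓ) (μ ∷ ws) w (ν ∷ vs) v

-- Naming the point μ by the fresh nominal x changes neither the states, the
-- relations nor the valuation, so actions are interpreted as before.  Reading
-- a level-(ℓ+1) pair of B with μ, ν held in the first register as a level-ℓ
-- pair of B^x, the clauses for x are the clauses of B for that register
-- ((wvar) and (atv) at index 0), and every other clause, including (st) and
-- (ex), is the corresponding clause of B one level up.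
module Submission where

open import Defs
open import Data.Nat using (ℕ; suc)
open import Data.Vec using ([]; _∷_)
open import Data.Fin using (zero; suc)
open import Data.Maybe using (just; nothing)
open import Data.Product using (_,_)
open import Data.Sum using (inj₁; inj₂)
open import Function.Base using (id)
open import Function.Bundles using (_⇔_; mk⇔; Equivalence)
open import Relation.Binary.PropositionalEquality using (_≡_; sym)
open import Relation.Binary.Construct.Closure.ReflexiveTransitive using (gmap)

module _ {Δ : Sig} (M : Model Δ) (μ : St M) where

  ⟦⟧-[x←]⁻ : (a : Act (Rel Δ)) {w w′ : St M} → ⟦ a ⟧ (M [x← μ ]) w w′ → ⟦ a ⟧ M w w′
  ⟦⟧-[x←]⁻ (atom r) p = p
  ⟦⟧-[x←]⁻ (a ∪ₐ b) (inj₁ p) = inj₁ (⟦⟧-[x←]⁻ a p)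
  ⟦⟧-[x←]⁻ (a ∪ₐ b) (inj₂ q) = inj₂ (⟦⟧-[x←]⁻ b q)
  ⟦⟧-[x←]⁻ (a ⨾ b) (u , p , q) = u , ⟦⟧-[x←]⁻ a p , ⟦⟧-[x←]⁻ b q
  ⟦⟧-[x←]⁻ (a ⋆) ps = gmap id (⟦⟧-[x←]⁻ a) ps

  ⟦⟧-[x←]⁺ : (a : Act (Rel Δ)) {w w′ : St M} → ⟦ a ⟧ M w w′ → ⟦ a ⟧ (M [x← μ ]) w w′
  ⟦⟧-[x←]⁺ (atom r) p = p
  ⟦⟧-[x←]⁺ (a ∪ₐ b) (inj₁ p) = inj₁ (⟦⟧-[x←]⁺ a p)
  ⟦⟧-[x←]⁺ (a ∪ₐ b) (inj₂ q) = inj₂ (⟦⟧-[x←]⁺ b q)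
  ⟦⟧-[x←]⁺ (a ⨾ b) (u , p , q) = u , ⟦⟧-[x←]⁺ a p , ⟦⟧-[x←]⁺ b q
  ⟦⟧-[x←]⁺ (a ⋆) ps = gmap id (⟦⟧-[x←]⁺ a) ps

≡-sym-⇔ : {A B : Set} {a a′ : A} {b b′ : B} →
          (a ≡ a′) ⇔ (b ≡ b′) → (a′ ≡ a) ⇔ (b′ ≡ b)
≡-sym-⇔ e = mk⇔ (λ p → sym (Equivalence.to e (sym p)))
                (λ q → sym (Equivalence.from e (sym q)))

module _ (L : Fragment) {Δ : Sig} {M N : Model Δ}
         (B : (ℓ : ℕ) → BRel M N ℓ) (μ : St M) (ν : St N) where

  shiftB-isLBisim : (ℓ : ℕ) → IsLBisim L M N (suc ℓ) (B (suc ℓ)) →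
                    IsLBisim L (M [x← μ ]) (N [x← ν ]) ℓ (shiftB {M = M} {N = N} B μ ν ℓ)
  shiftB-isLBisim ℓ isB = record
    { prop  = prop
    ; nomc  = λ { b nothing → ≡-sym-⇔ (wvar b zero) ; b (just k) → nomc b k }
    ; wvar  = λ b j → wvar b (suc j)
    ; forth = λ d b a la w′ r →
        let v′ , r′ , b′ = forth d b a la w′ (⟦⟧-[x←]⁻ M μ a r)
        in  v′ , ⟦⟧-[x←]⁺ N ν a r′ , b′
    ; back  = λ d b a la v′ r →
        let w′ , r′ , b′ = back d b a la v′ (⟦⟧-[x←]⁻ N ν a r)
        in  w′ , ⟦⟧-[x←]⁺ M μ a r′ , b′
    ; atv   = λ d b j → atv d b (suc j)
    ; atn   = λ { d b nothing → atv d b zero ; d b (just k) → atn d b k }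
    }
    where open IsLBisim isB

  -- (st) and (ex) transfer verbatim: (μ ∷ ws) ∷ʳ w reduces to μ ∷ (ws ∷ʳ w).
  shiftB-isωBisim : IsωBisim L M N B →
                    IsωBisim L (M [x← μ ]) (N [x← ν ]) (shiftB {M = M} {N = N} B μ ν)
  shiftB-isωBisim isB = record
    { level = λ ℓ → shiftB-isLBisim ℓ (level (suc ℓ))
    ; st    = λ d b → st d b
    ; ex    = λ d b → ex d b
    }
    where open IsωBisim isB

mainTheorem3 : (L : Fragment) {Δ : Sig} (M N : Model Δ)
    (B : (ℓ : ℕ) → BRel M N ℓ) (μ μ′ : St M) (ν ν′ : St N) →
    IsωBisim L M N B → B 0 [] μ [] ν → B 1 (μ ∷ []) μ′ (ν ∷ []) ν′ →
    IsPointedωBisim L (M [x← μ ]) (N [x← ν ]) (shiftB {M = M} {N = N} B μ ν) μ′ ν′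
mainTheorem3 L M N B μ μ′ ν ν′ isB _ μ′Bν′ = shiftB-isωBisim L B μ ν isB , μ′Bν′
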